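{- Every $\sqrt{\mathfrak{gl}_n}$-crystal is a $\mathfrak{gl}_n$-crystal with respect to the same weight map and the operators $(e'_i)^2$ and $(f'_i)^2$ for $i\in[n-1]$ (using the convention $e'_i(0)=f'_i(0)=0$), and this $\mathfrak{gl}_n$-crystal is seminormal. Likewise every $\sqrt{\mathfrak{q}_n}$-crystal is a $\mathfrak{q}_n$-crystal with respect to the operators $(e'_i)^2,(f'_i)^2$ for $i\in\{\overline 1,1,\dots,n-1\}$, and it is seminormal as a $\mathfrak{gl}_n$-crystal.
   Context: Let $n\ge2$. A $\mathfrak{gl}_n$-crystal is a set $\mathcal{B}$ with $\operatorname{wt}:\mathcal{B}\to\mathbb{Z}^n$ and $e_i,f_i:\mathcal{B}\to\mathcal{B}\sqcup\{0\}$ ($i\in[n-1]$, $0\notin\mathcal{B}$) such that $e_i(b)=c$ iff $f_i(c)=b$, in which case $\operatorname{wt}(c)=\operatorname{wt}(b)+\mathbf{e}_i-\mathbf{e}_{i+1}$. With $\varepsilon_i(b)=\sup\{k\ge0:e_i^k(b)\ne0\}$ and $\varphi_i(b)=\sup\{k\ge0:f_i^k(b)\ne0\}$, it is seminormal if these are finite and $\varphi_i(b)-\varepsilon_i(b)=\operatorname{wt}(b)_i-\operatorname{wt}(b)_{i+1}$. A $\mathfrak{q}_n$-crystal is a $\mathfrak{gl}_n$-crystal with extra $e_{\overline 1},f_{\overline 1}:\mathcal{B}\to\mathcal{B}\sqcup\{0\}$ such that for $3\le i\le n-1$, $e_{\overline1},f_{\overline1}$ commute with $e_i,f_i$ and preserve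 $\varepsilon_i,\varphi_i$ (values unchanged when the result is nonzero), and $e_{\overline 1}(b)=c$ iff $f_{\overline 1}(c)=b$, in which case $\operatorname{wt}(c)=\operatorname{wt}(b)+\mathbf{e}_1-\mathbf{e}_2$. A $\sqrt{\mathfrak{gl}_n}$-crystal is a set $\mathcal{B}$ with $\operatorname{wt}:\mathcal{B}\to\mathbb{N}^n$ and $e'_i,f'_i:\mathcal{B}\to\mathcal{B}\sqcup\{0\}$ ($i\in[n-1]$); set $\varepsilon'_i(b)=\sup\{k\ge0:(e'_i)^k(b)\ne0\}$, $\varphi'_i(b)=\sup\{k\ge0:(f'_i)^k(b)\ne0\}$. Require for all $i$ and $b,c$: (a) $\varepsilon'_i(b)+\varphi'_i(b)\in2\mathbb{N}$ (in particular finite) and $\frac{\varphi'_i(b)-\varepsilon'_i(b)}{2}=\operatorname{wt}(b)_i-\operatorname{wt}(b)_{i+1}$; (b) $e'_i(b)=c$ iff $b=f'_i(c)$, in which case $\operatorname{wt}(c)-\operatorname{wt}(b)=\mathbf{e}_i$ if $\varepsilon'_i(b)$ is even and $=-\mathbf{e}_{i+1}$ if $\varepsilon'_i(b)$ is odd. A $\sqrt{\mathfrak{q}_n}$-crystal is a $\sqrt{\mathfrak{gl}_n}$-crystal with extra maps $e'_{\overline1},f'_{\overline1}:\mathcal{B}\to\mathcal{B}\sqcup\{0\}$ (with $\varepsilon'_{\overline1},\varphi'_{\overline1}$ defined analogously) that commute with $e'_i,f'_i$ and preserve $\varepsilon'_i,\varphi'_i$ for $3\le i\le n-1$, such that (a)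 $\varepsilon'_{\overline1}(b)+\varphi'_{\overline1}(b)$ equals $0$ if $\operatorname{wt}(b)_1=\operatorname{wt}(b)_2=0$ and $2$ otherwise; (b) $e'_{\overline1}(b)=c$ iff $b=f'_{\overline1}(c)$, in which case $\operatorname{wt}(c)-\operatorname{wt}(b)=\mathbf{e}_1$ if $\varepsilon'_{\overline1}(b)=2$ and $=-\mathbf{e}_2$ if $\varepsilon'_{\overline1}(b)=1$. -}

module Defs where

open import Data.Nat as ℕ using (ℕ; zero; suc)
open import Data.Integer as ℤ using (ℤ; +_)
open import Data.Fin using (Fin; zero; suc; inject₁; toℕ)
open import Data.Maybe using (Maybe; just; nothing; _>>=_)
open import Data.Product using (_×_; ∃; ∃-syntax; _,_)
open import Relation.Binary.PropositionalEquality using (_≡_; _≢_)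
open import Relation.Nullary using (¬_)

-- Convention: n = suc (suc k) (so n ≥ 2 automatically).  Indices i ∈ [n-1]
-- are i : Fin (suc k) ; the 1-based index i corresponds to toℕ i + 1, and
-- coordinates i, i+1 of a weight in Fin n are inject₁ i and suc i.
-- The element 0 ∉ B is modelled by nothing : Maybe B.

Even : ℕ → Set
Even k = ∃[ t ] k ≡ 2 ℕ.* t

Odd : ℕ → Set
Odd k = ∃[ t ] k ≡ suc (2 ℕ.* t)

_⇔_ : Set → Set → Set
A ⇔ B = (A → B) × (B → A)

iter : {B : Set} → (B → Maybe B) → ℕ → B → Maybe B
iter g zero b = just b
iter g (suc k) b = iter g k b >>= g

sq : {B : Set} → (B → Maybe B) → B → Maybe B
sq g b = g b >>= g

-- sup{ k ≥ 0 : g^k(b) ≠ 0 } = k  (a finite value).  Since g(0) = 0 this is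
-- exactly: g^k(b) ≠ 0 and g^(k+1)(b) = 0.  sup = ∞ iff no such k exists.
IsSup : {B : Set} → (B → Maybe B) → B → ℕ → Set
IsSup g b k = (iter g k b ≢ nothing) × (iter g (suc k) b ≡ nothing)

SameSup : {B : Set} → (B → Maybe B) → B → B → Set
SameSup g b c = ∀ k → IsSup g b k ⇔ IsSup g c k

δℤ : {n : ℕ} → Fin n → Fin n → ℤ
δℤ zero zero = + 1
δℤ (suc i) (suc j) = δℤ i j
δℤ _ _ = + 0

δℕ : {n : ℕ} → Fin n → Fin n → ℕ
δℕ zero zero = 1
δℕ (suc i) (suc j) = δℕ i j
δℕ _ _ = 0

record IsGlCrystal (k : ℕ) (B : Set) (wt : B → Fin (suc (suc k)) → ℤ)
                   (e f : Fin (suc k) → B → Maybe B) : Set where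
  field
    e⇒f : ∀ i b c → e i b ≡ just c → f i c ≡ just b
    f⇒e : ∀ i b c → f i c ≡ just b → e i b ≡ just c
    wt-e : ∀ i b c → e i b ≡ just c →
           ∀ j → wt c j ≡ wt b j ℤ.+ (δℤ (inject₁ i) j ℤ.- δℤ (suc i) j)

IsSeminormal : (k : ℕ) (B : Set) (wt : B → Fin (suc (suc k)) → ℤ)
               (e f : Fin (suc k) → B → Maybe B) → Set
IsSeminormal k B wt e f =
  ∀ i b → ∃[ ε ] ∃[ φ ] IsSup (e i) b ε × IsSup (f i) b φ ×
          (+ φ ℤ.- + ε ≡ wt b (inject₁ i) ℤ.- wt b (suc i))

-- the indices 3 ≤ i ≤ n-1 (1-based) are those with toℕ i ≥ 2
record IsQCrystal (k : ℕ) (B : Set) (wt : B → Fin (suc (suc k)) → ℤ)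
                  (e f : Fin (suc k) → B → Maybe B)
                  (e₁ f₁ : B → Maybe B) : Set where
  field
    gl : IsGlCrystal k B wt e f
    comm-ee : ∀ i → 2 ℕ.≤ toℕ i → ∀ b → (e₁ b >>= e i) ≡ (e i b >>= e₁)
    comm-ef : ∀ i → 2 ℕ.≤ toℕ i → ∀ b → (e₁ b >>= f i) ≡ (f i b >>= e₁)
    comm-fe : ∀ i → 2 ℕ.≤ toℕ i → ∀ b → (f₁ b >>= e i) ≡ (e i b >>= f₁)
    comm-ff : ∀ i → 2 ℕ.≤ toℕ i → ∀ b → (f₁ b >>= f i) ≡ (f i b >>= f₁)
    pres-e : ∀ i → 2 ℕ.≤ toℕ i → ∀ b c → e₁ b ≡ just c →
             SameSup (e i) b c × SameSup (f i) b c
    pres-f : ∀ i → 2 ℕ.≤ toℕ i → ∀ b c → f₁ b ≡ just c →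
             SameSup (e i) b c × SameSup (f i) b c
    e₁⇒f₁ : ∀ b c → e₁ b ≡ just c → f₁ c ≡ just b
    f₁⇒e₁ : ∀ b c → f₁ c ≡ just b → e₁ b ≡ just c
    wt-e₁ : ∀ b c → e₁ b ≡ just c →
            ∀ j → wt c j ≡ wt b j ℤ.+ (δℤ zero j ℤ.- δℤ (suc zero) j)

record IsSqrtGlCrystal (k : ℕ) (B : Set) (wt : B → Fin (suc (suc k)) → ℕ)
                       (e f : Fin (suc k) → B → Maybe B) : Set where
  field
    ax-a : ∀ i b → ∃[ ε ] ∃[ φ ] IsSup (e i) b ε × IsSup (f i) b φ ×
           Even (ε ℕ.+ φ) ×
           (+ φ ℤ.- + ε ≡ + 2 ℤ.* (+ wt b (inject₁ i) ℤ.- + wt b (suc i)))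
    e⇒f : ∀ i b c → e i b ≡ just c → f i c ≡ just b
    f⇒e : ∀ i b c → f i c ≡ just b → e i b ≡ just c
    wt-e : ∀ i b c → e i b ≡ just c → ∀ ε → IsSup (e i) b ε →
           (Even ε → ∀ j → wt c j ≡ wt b j ℕ.+ δℕ (inject₁ i) j) ×
           (Odd ε → ∀ j → wt b j ≡ wt c j ℕ.+ δℕ (suc i) j)

record IsSqrtQCrystal (k : ℕ) (B : Set) (wt : B → Fin (suc (suc k)) → ℕ)
                      (e f : Fin (suc k) → B → Maybe B)
                      (e₁ f₁ : B → Maybe B) : Set where
  field
    sgl : IsSqrtGlCrystal k B wt e f
    comm-ee : ∀ i → 2 ℕ.≤ toℕ i → ∀ b → (e₁ b >>= e i) ≡ (e i b >>= e₁)
    comm-ef : ∀ i → 2 ℕ.≤ toℕ i → ∀ b → (e₁ b >>= f i) ≡ (f i b >>= e₁)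
    comm-fe : ∀ i → 2 ℕ.≤ toℕ i → ∀ b → (f₁ b >>= e i) ≡ (e i b >>= f₁)
    comm-ff : ∀ i → 2 ℕ.≤ toℕ i → ∀ b → (f₁ b >>= f i) ≡ (f i b >>= f₁)
    pres-e : ∀ i → 2 ℕ.≤ toℕ i → ∀ b c → e₁ b ≡ just c →
             SameSup (e i) b c × SameSup (f i) b c
    pres-f : ∀ i → 2 ℕ.≤ toℕ i → ∀ b c → f₁ b ≡ just c →
             SameSup (e i) b c × SameSup (f i) b c
    ax-a : ∀ b → ∃[ ε ] ∃[ φ ] IsSup e₁ b ε × IsSup f₁ b φ ×
           ((wt b zero ≡ 0 × wt b (suc zero) ≡ 0) → ε ℕ.+ φ ≡ 0) ×
           (¬ (wt b zero ≡ 0 × wt b (suc zero) ≡ 0) → ε ℕ.+ φ ≡ 2)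
    e₁⇒f₁ : ∀ b c → e₁ b ≡ just c → f₁ c ≡ just b
    f₁⇒e₁ : ∀ b c → f₁ c ≡ just b → e₁ b ≡ just c
    wt-e₁ : ∀ b c → e₁ b ≡ just c →
            (IsSup e₁ b 2 → ∀ j → wt c j ≡ wt b j ℕ.+ δℕ zero j) ×
            (IsSup e₁ b 1 → ∀ j → wt b j ≡ wt c j ℕ.+ δℕ (suc zero) j)

toℤwt : {k : ℕ} {B : Set} → (B → Fin k → ℕ) → B → Fin k → ℤ
toℤwt wt b j = + wt b j

{-# OPTIONS --safe #-}
module Submission where

-- A single e'ᵢ raises wtᵢ or lowers wtᵢ₊₁ according to the parity of ε'ᵢ, and
-- ε'ᵢ drops by one along e'ᵢ; so the two steps of (e'ᵢ)² have opposite parities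
-- and together shift the weight by 𝐞ᵢ - 𝐞ᵢ₊₁.  The string lengths of (e'ᵢ)² and
-- (f'ᵢ)² are ⌊ε'ᵢ/2⌋ and ⌊φ'ᵢ/2⌋; as ε'ᵢ + φ'ᵢ is even the two halvings lose the
-- same remainder, whence seminormality.  For e'₁̄ the bound ε' + φ' ≤ 2 forces
-- ε'₁̄ = 2 wherever (e'₁̄)² is defined, so its two steps are again of opposite kinds.

open import Defs
open import Data.Nat using (ℕ; zero; suc; _+_; _*_; _∸_)
import Data.Nat.Properties as ℕ
open import Algebra.Properties.CommutativeSemigroup ℕ.+-commutativeSemigroup
  using (xy∙z≈xz∙y)
open import Data.Integer as ℤ using (+_; _⊖_)
import Data.Integer.Properties as ℤ
open import Data.Fin using (Fin; zero; suc; inject₁)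
open import Data.Maybe using (Maybe; just; nothing; _>>=_)
open import Data.Product using (_×_; _,_; proj₁; proj₂; ∃; ∃-syntax)
open import Data.Empty using (⊥-elim)
open import Relation.Nullary using (¬_)
open import Relation.Binary.PropositionalEquality
open ≡-Reasoning

Commute : {B : Set} → (B → Maybe B) → (B → Maybe B) → Set
Commute p q = ∀ b → (p b >>= q) ≡ (q b >>= p)

data FloorHalf : ℕ → ℕ → Set where
  even : ∀ t → FloorHalf (2 * t) t
  odd  : ∀ t → FloorHalf (suc (2 * t)) t

floorHalf : ∀ m → ∃ (FloorHalf m)
floorHalf zero = 0 , even 0
floorHalf (suc m) with floorHalf m
... | t , even t = t , odd t
... | t , odd t = suc t , subst (λ n → FloorHalf n (suc t)) (ℕ.*-suc 2 t) (even (suc t))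

module _ {B : Set} where

  >>=-identityʳ : (m : Maybe B) → (m >>= just) ≡ m
  >>=-identityʳ nothing = refl
  >>=-identityʳ (just x) = refl

  >>=-assoc : (m : Maybe B) (p q : B → Maybe B) →
              ((m >>= p) >>= q) ≡ (m >>= λ x → p x >>= q)
  >>=-assoc nothing p q = refl
  >>=-assoc (just x) p q = refl

  iter-sucˡ : ∀ (g : B → Maybe B) k b → iter g (suc k) b ≡ (g b >>= iter g k)
  iter-sucˡ g zero b = sym (>>=-identityʳ (g b))
  iter-sucˡ g (suc k) b =
    trans (cong (_>>= g) (iter-sucˡ g k b)) (>>=-assoc (g b) (iter g k) g)

  iter-sq : ∀ (g : B → Maybe B) t b → iter (sq g) t b ≡ iter g (2 * t) b
  iter-sq-suc : ∀ (g : B → Maybe B) t b →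
                iter (sq g) (suc t) b ≡ iter g (suc (suc (2 * t))) b

  iter-sq g zero b = refl
  iter-sq g (suc t) b =
    trans (iter-sq-suc g t b) (cong (λ n → iter g n b) (sym (ℕ.*-suc 2 t)))

  iter-sq-suc g t b =
    trans (cong (_>>= sq g) (iter-sq g t b)) (sym (>>=-assoc (iter g (2 * t) b) g g))

  IsSup-pred : ∀ (g : B → Maybe B) {b d m} →
               g b ≡ just d → IsSup g b (suc m) → IsSup g d m
  IsSup-pred g {b} {d} {m} bd (ne , eq) =
    (λ z → ne (trans (iter-sucˡ g m b) (trans (cong (_>>= iter g m) bd) z))) ,
    trans (cong (_>>= iter g (suc m)) (sym bd)) (trans (sym (iter-sucˡ g (suc m) b)) eq)

  ¬IsSup-zero : ∀ (g : B → Maybe B) {b d} → g b ≡ just d → ¬ IsSup g b 0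
  ¬IsSup-zero g bd (_ , eq) with trans (sym bd) eq
  ... | ()

  IsSup-sq : ∀ (g : B → Maybe B) {b m t} → FloorHalf m t → IsSup g b m → IsSup (sq g) b t
  IsSup-sq g {b} (even t) (ne , eq) =
    (λ z → ne (trans (sym (iter-sq g t b)) z)) ,
    trans (iter-sq-suc g t b) (cong (_>>= g) eq)
  IsSup-sq g {b} (odd t) (ne , eq) =
    (λ z → ne (cong (_>>= g) (trans (sym (iter-sq g t b)) z))) ,
    trans (iter-sq-suc g t b) eq

  IsSup-sq⁻¹ : ∀ (g : B → Maybe B) {b t} →
               IsSup (sq g) b t → ∃[ m ] FloorHalf m t × IsSup g b m
  IsSup-sq⁻¹ g {b} {t} (ne , eq) with iter g (suc (2 * t)) b in last
  ... | nothing = 2 * t , even t , (λ z → ne (trans (iter-sq g t b) z)) , last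
  ... | just _  = suc (2 * t) , odd t , (λ z → just≢nothing (trans (sym last) z)) ,
                  trans (sym (iter-sq-suc g t b)) eq
    where
    just≢nothing : ∀ {x : B} → just x ≢ nothing
    just≢nothing ()

  SameSup-trans : ∀ {g : B → Maybe B} {a b c} →
                  SameSup g a b → SameSup g b c → SameSup g a c
  SameSup-trans S T m =
    (λ s → proj₁ (T m) (proj₁ (S m) s)) , (λ s → proj₂ (S m) (proj₂ (T m) s))

  SameSup-sq : ∀ {g : B → Maybe B} {b c} → SameSup g b c → SameSup (sq g) b c
  SameSup-sq {g} S t = transport (λ m → proj₁ (S m)) , transport (λ m → proj₂ (S m))
    where
    transport : ∀ {x y} → (∀ m → IsSup g x m → IsSup g y m) →
                IsSup (sq g) x t → IsSup (sq g) y t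
    transport h s with IsSup-sq⁻¹ g {t = t} s
    ... | m , half , sup = IsSup-sq g half (h m sup)

  sq-just : ∀ (g : B → Maybe B) {b c} →
            sq g b ≡ just c → ∃[ d ] g b ≡ just d × g d ≡ just c
  sq-just g {b} bc with g b
  ... | just d = d , refl , bc

  sq-inverse : ∀ {p q : B → Maybe B} → (∀ b c → p b ≡ just c → q c ≡ just b) →
               ∀ b c → sq p b ≡ just c → sq q c ≡ just b
  sq-inverse {p} {q} inv b c bc with sq-just p bc
  ... | d , bd , dc = trans (cong (_>>= q) (inv d c dc)) (inv b d bd)

  sq-preservesSups : ∀ {g h p : B → Maybe B} →
    (∀ b c → p b ≡ just c → SameSup g b c × SameSup h b c) →
    ∀ b c → sq p b ≡ just c → SameSup (sq g) b c × SameSup (sq h) b c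
  sq-preservesSups {p = p} H b c bc with sq-just p bc
  ... | d , bd , dc =
    SameSup-sq (SameSup-trans (proj₁ (H b d bd)) (proj₁ (H d c dc))) ,
    SameSup-sq (SameSup-trans (proj₂ (H b d bd)) (proj₂ (H d c dc)))

  sq-commute : ∀ (p q : B → Maybe B) → Commute p q → Commute (sq p) (sq q)
  sq-commute p q pq b = begin
    ((p b >>= p) >>= sq q)       ≡⟨ >>=-assoc (p b >>= p) q q ⟨
    (((p b >>= p) >>= q) >>= q)  ≡⟨ cong (_>>= q) (lift (p b)) ⟩
    (((p b >>= q) >>= p) >>= q)  ≡⟨ lift (p b >>= q) ⟩
    (((p b >>= q) >>= q) >>= p)  ≡⟨ cong (λ m → (m >>= q) >>= p) (pq b) ⟩
    (((q b >>= p) >>= q) >>= p)  ≡⟨ cong (_>>= p) (lift (q b)) ⟩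
    (((q b >>= q) >>= p) >>= p)  ≡⟨ >>=-assoc (q b >>= q) p p ⟩
    ((q b >>= q) >>= sq p)       ∎
    where
    lift : ∀ m → ((m >>= p) >>= q) ≡ ((m >>= q) >>= p)
    lift nothing = refl
    lift (just x) = pq x

δℤ≡+δℕ : ∀ {n} (i j : Fin n) → δℤ i j ≡ + δℕ i j
δℤ≡+δℕ zero zero = refl
δℤ≡+δℕ zero (suc j) = refl
δℤ≡+δℕ (suc i) zero = refl
δℤ≡+δℕ (suc i) (suc j) = δℤ≡+δℕ i j

c+y≡b+x⇒c≡b+[x-y] : ∀ {b c x y} → c + y ≡ b + x → + c ≡ + b ℤ.+ (+ x ℤ.- + y)
c+y≡b+x⇒c≡b+[x-y] {b} {c} {x} {y} eq = begin
  + c                    ≡⟨ cong +_ (ℕ.m+n∸n≡m c y) ⟨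
  + (c + y ∸ y)          ≡⟨ ℤ.⊖-≥ (ℕ.m≤n+m y c) ⟨
  (c + y) ⊖ y            ≡⟨ cong (_⊖ y) eq ⟩
  (b + x) ⊖ y            ≡⟨ ℤ.distribʳ-⊖-+-pos b x y ⟨
  + b ℤ.+ (x ⊖ y)        ≡⟨ cong (λ z → + b ℤ.+ z) (ℤ.m-n≡m⊖n x y) ⟨
  + b ℤ.+ (+ x ℤ.- + y)  ∎

toℤwt-shift : ∀ {k} {B : Set} {wt : B → Fin k → ℕ} {b c} (x y : Fin k) →
  (∀ j → wt c j + δℕ y j ≡ wt b j + δℕ x j) →
  ∀ j → toℤwt wt c j ≡ toℤwt wt b j ℤ.+ (δℤ x j ℤ.- δℤ y j)
toℤwt-shift x y eq j rewrite δℤ≡+δℕ x j | δℤ≡+δℕ y j = c+y≡b+x⇒c≡b+[x-y] (eq j)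

[2p]-[2q] : ∀ p q → + (2 * p) ℤ.- + (2 * q) ≡ + 2 ℤ.* (+ p ℤ.- + q)
[2p]-[2q] p q = begin
  + (2 * p) ℤ.- + (2 * q)           ≡⟨ cong₂ ℤ._-_ (ℤ.pos-* 2 p) (ℤ.pos-* 2 q) ⟩
  + 2 ℤ.* + p ℤ.- + 2 ℤ.* + q
    ≡⟨ cong (λ z → + 2 ℤ.* + p ℤ.+ z) (ℤ.neg-distribʳ-* (+ 2) (+ q)) ⟩
  + 2 ℤ.* + p ℤ.+ + 2 ℤ.* ℤ.- + q  ≡⟨ ℤ.*-distribˡ-+ (+ 2) (+ p) (ℤ.- + q) ⟨
  + 2 ℤ.* (+ p ℤ.- + q)             ∎

[1+m]-[1+n] : ∀ m n → + suc m ℤ.- + suc n ≡ + m ℤ.- + n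
[1+m]-[1+n] m n = begin
  + suc m ℤ.- + suc n  ≡⟨ ℤ.m-n≡m⊖n (suc m) (suc n) ⟩
  suc m ⊖ suc n        ≡⟨ ℤ.[1+m]⊖[1+n]≡m⊖n m n ⟩
  m ⊖ n                ≡⟨ ℤ.m-n≡m⊖n m n ⟨
  + m ℤ.- + n          ∎

floorHalf-sub : ∀ {ε φ q p} → Even (ε + φ) → FloorHalf ε q → FloorHalf φ p →
                + φ ℤ.- + ε ≡ + 2 ℤ.* (+ p ℤ.- + q)
floorHalf-sub _ (even q) (even p) = [2p]-[2q] p q
floorHalf-sub _ (odd q) (odd p) =
  trans ([1+m]-[1+n] (2 * p) (2 * q)) ([2p]-[2q] p q)
floorHalf-sub (s , ev) (even q) (odd p) =
  ⊥-elim (ℕ.even≢odd s (q + p) (begin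
    2 * s                ≡⟨ ev ⟨
    2 * q + suc (2 * p)  ≡⟨ ℕ.+-suc (2 * q) (2 * p) ⟩
    suc (2 * q + 2 * p)  ≡⟨ cong suc (ℕ.*-distribˡ-+ 2 q p) ⟨
    suc (2 * (q + p))    ∎))
floorHalf-sub (s , ev) (odd q) (even p) =
  ⊥-elim (ℕ.even≢odd s (q + p) (trans (sym ev) (cong suc (sym (ℕ.*-distribˡ-+ 2 q p)))))

module _ {k B wt e f} (S : IsSqrtGlCrystal k B wt e f) where
  open IsSqrtGlCrystal S

  wt-e-twice : ∀ i {b d c} → e i b ≡ just d → e i d ≡ just c →
               ∀ j → wt c j + δℕ (suc i) j ≡ wt b j + δℕ (inject₁ i) j
  wt-e-twice i {b} {d} {c} bd dc j with ax-a i b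
  ... | zero , _ , sup , _ = ⊥-elim (¬IsSup-zero (e i) bd sup)
  ... | suc m , _ , sup , _ with floorHalf m | IsSup-pred (e i) {m = m} bd sup
  ... | t , even t | sup′ = begin
    wt c j + δℕ (suc i) j                     ≡⟨ cong (_+ δℕ (suc i) j) d→c ⟩
    wt d j + δℕ (inject₁ i) j + δℕ (suc i) j  ≡⟨ xy∙z≈xz∙y (wt d j) _ _ ⟩
    wt d j + δℕ (suc i) j + δℕ (inject₁ i) j  ≡⟨ cong (_+ δℕ (inject₁ i) j) b→d ⟨
    wt b j + δℕ (inject₁ i) j                 ∎
    where
    d→c : wt c j ≡ wt d j + δℕ (inject₁ i) j
    d→c = proj₁ (wt-e i d c dc _ sup′) (t , refl) j
    b→d : wt b j ≡ wt d j + δℕ (suc i) j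
    b→d = proj₂ (wt-e i b d bd _ sup) (t , refl) j
  ... | t , odd t | sup′ = begin
    wt c j + δℕ (suc i) j      ≡⟨ proj₂ (wt-e i d c dc _ sup′) (t , refl) j ⟨
    wt d j                     ≡⟨ proj₁ (wt-e i b d bd _ sup) (suc t , sym (ℕ.*-suc 2 t)) j ⟩
    wt b j + δℕ (inject₁ i) j  ∎

  sq-isGlCrystal : IsGlCrystal k B (toℤwt wt) (λ i → sq (e i)) (λ i → sq (f i))
  sq-isGlCrystal = record
    { e⇒f = λ i → sq-inverse (e⇒f i)
    ; f⇒e = λ i b c → sq-inverse (λ c b → f⇒e i b c) c b
    ; wt-e = λ i b c bc → let d , bd , dc = sq-just (e i) bc in
               toℤwt-shift {wt = wt} (inject₁ i) (suc i) (wt-e-twice i bd dc)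
    }

  sq-isSeminormal : IsSeminormal k B (toℤwt wt) (λ i → sq (e i)) (λ i → sq (f i))
  sq-isSeminormal i b with ax-a i b
  ... | ε , φ , supε , supφ , sum-even , φ-ε with floorHalf ε | floorHalf φ
  ... | q , ε/2 | p , φ/2 =
    q , p , IsSup-sq (e i) ε/2 supε , IsSup-sq (f i) φ/2 supφ ,
    ℤ.*-cancelˡ-≡ (+ 2) _ _ (trans (sym (floorHalf-sub sum-even ε/2 φ/2)) φ-ε)

module _ {k B wt e f e₁ f₁} (S : IsSqrtQCrystal k B wt e f e₁ f₁) where
  open IsSqrtQCrystal S

  e₁-twice-sup : ∀ {b d c} → e₁ b ≡ just d → e₁ d ≡ just c → IsSup e₁ b 2
  e₁-twice-sup {b} bd dc with ax-a b
  ... | zero , _ , sup , _ = ⊥-elim (¬IsSup-zero e₁ bd sup)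
  ... | suc zero , _ , sup , _ = ⊥-elim (¬IsSup-zero e₁ dc (IsSup-pred e₁ {m = 0} bd sup))
  ... | suc (suc m) , φ , sup , _ , sum≡0 , sum≡2 =
    subst (IsSup e₁ b) (cong (λ n → suc (suc n)) m≡0) sup
    where
    m≡0 : m ≡ 0
    m≡0 = ℕ.m+n≡0⇒m≡0 m (ℕ.suc-injective (ℕ.suc-injective
            (sum≡2 (λ wt≡0 → ℕ.1+n≢0 (sum≡0 wt≡0)))))

  wt-e₁-twice : ∀ {b d c} → e₁ b ≡ just d → e₁ d ≡ just c →
                ∀ j → wt c j + δℕ (suc zero) j ≡ wt b j + δℕ zero j
  wt-e₁-twice {b} {d} {c} bd dc j = begin
    wt c j + δℕ (suc zero) j  ≡⟨ proj₂ (wt-e₁ d c dc) (IsSup-pred e₁ {m = 1} bd sup) j ⟨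
    wt d j                    ≡⟨ proj₁ (wt-e₁ b d bd) sup j ⟩
    wt b j + δℕ zero j        ∎
    where
    sup : IsSup e₁ b 2
    sup = e₁-twice-sup bd dc

  sq-isQCrystal :
    IsQCrystal k B (toℤwt wt) (λ i → sq (e i)) (λ i → sq (f i)) (sq e₁) (sq f₁)
  sq-isQCrystal = record
    { gl      = sq-isGlCrystal sgl
    ; comm-ee = λ i i≥2 → sq-commute e₁ (e i) (comm-ee i i≥2)
    ; comm-ef = λ i i≥2 → sq-commute e₁ (f i) (comm-ef i i≥2)
    ; comm-fe = λ i i≥2 → sq-commute f₁ (e i) (comm-fe i i≥2)
    ; comm-ff = λ i i≥2 → sq-commute f₁ (f i) (comm-ff i i≥2)
    ; pres-e  = λ i i≥2 → sq-preservesSups (pres-e i i≥2)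
    ; pres-f  = λ i i≥2 → sq-preservesSups (pres-f i i≥2)
    ; e₁⇒f₁   = sq-inverse e₁⇒f₁
    ; f₁⇒e₁   = λ b c → sq-inverse (λ c b → f₁⇒e₁ b c) c b
    ; wt-e₁   = λ b c bc → let d , bd , dc = sq-just e₁ bc in
                  toℤwt-shift {wt = wt} zero (suc zero) (wt-e₁-twice bd dc)
    }

proposition3p14 :
    ((k : ℕ) (B : Set) (wt : B → Fin (suc (suc k)) → ℕ)
      (e f : Fin (suc k) → B → Maybe B) →
      IsSqrtGlCrystal k B wt e f →
      IsGlCrystal k B (toℤwt wt) (λ i → sq (e i)) (λ i → sq (f i)) ×
      IsSeminormal k B (toℤwt wt) (λ i → sq (e i)) (λ i → sq (f i)))
    ×
    ((k : ℕ) (B : Set) (wt : B → Fin (suc (suc k)) → ℕ)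
      (e f : Fin (suc k) → B → Maybe B) (e₁ f₁ : B → Maybe B) →
      IsSqrtQCrystal k B wt e f e₁ f₁ →
      IsQCrystal k B (toℤwt wt) (λ i → sq (e i)) (λ i → sq (f i)) (sq e₁) (sq f₁) ×
      IsSeminormal k B (toℤwt wt) (λ i → sq (e i)) (λ i → sq (f i)))
proposition3p14 =
  (λ _ _ _ _ _ S → sq-isGlCrystal S , sq-isSeminormal S) ,
  (λ _ _ _ _ _ _ _ S → sq-isQCrystal S , sq-isSeminormal (IsSqrtQCrystal.sgl S))
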